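{- Let $p$ be a prime, $r\ge 2$ an integer, and let $f\colon\mathbb{Z}\to\mathbb{F}_p$ be the function determined by $f(k+r) = -f(k)-f(k+1)$ for all $k\in\mathbb{Z}$, together with $f(0)=1$ and $f(1)=\dots=f(r-1)=0$. Fix an integer $n>r$ and define the $n\times n$ matrix $M$ over $\mathbb{F}_p$, with rows and columns indexed by $\{0,\dots,n-1\}$, by $M_{k,\ell} := f(k-\ell)$. Then $M$ is a fooling-set matrix if and only if $f(k)f(-k)=0$ for all $k\in\{1,\dots,n-1\}$.
   Context: An $n\times n$ matrix $M$ over a field is called a fooling-set matrix of size $n$ if all its diagonal entries $M_{k,k}$ are nonzero and $M_{k,\ell}M_{\ell,k}=0$ for all $k\neq \ell$. -}

module Defs where

open import Data.Nat using (ℕ)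
open import Data.Fin using (Fin)
open import Data.Integer using (ℤ; +_; _-_; _*_)
open import Data.Integer.Divisibility using (_∣_)
open import Data.Product using (_×_)
open import Relation.Nullary using (¬_)
open import Relation.Binary.PropositionalEquality using (_≢_)

-- The prime field F_p is modelled as ℤ modulo p (a setoid):
-- an integer a represents the class a mod p.

IsZero : ℕ → ℤ → Set
IsZero p a = (+ p) ∣ a

_≡[_]_ : ℤ → ℕ → ℤ → Set
a ≡[ p ] b = IsZero p (a - b)

infix 4 _≡[_]_

IsFoolingSet : (p n : ℕ) → (Fin n → Fin n → ℤ) → Set
IsFoolingSet p n M =
  (∀ k → ¬ IsZero p (M k k)) ×
  (∀ k l → k ≢ l → IsZero p (M k l * M l k))

module Submission where

open import Defs
open import Data.Nat using (ℕ; _≤_; _<_; _∸_)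
open import Data.Nat.Primality using (Prime; ¬prime[1])
open import Data.Nat.Divisibility using (∣1⇒≡1)
open import Data.Fin using (Fin; toℕ; fromℕ<)
open import Data.Fin.Properties using (toℕ-fromℕ<; toℕ-injective; toℕ<n)
open import Data.Integer using (ℤ; +_; -_; _+_; _-_; _*_; 0ℤ; 1ℤ; -1ℤ)
open import Data.Integer.Divisibility.Signed using (_∣_; ∣ᵤ⇒∣; ∣⇒∣ᵤ; ∣m⇒∣-m; ∣m+n∣m⇒∣n)
open import Data.Product using (_,_)
open import Function using (_∘_)
open import Function.Bundles using (_⇔_; mk⇔)
open import Relation.Binary using (tri<; tri≈; tri>)
open import Relation.Binary.PropositionalEquality
open import Relation.Nullary using (¬_)
open import Data.Empty using (⊥-elim)
import Data.Nat.Properties as ℕ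
import Data.Integer.Properties as ℤ

≡1⇒¬IsZero : ∀ {p} a → Prime p → a ≡[ p ] 1ℤ → ¬ IsZero p a
≡1⇒¬IsZero {p} a p-prime a≡1 a≡0 = ¬prime[1] (subst Prime p≡1 p-prime)
  where
  p∣-1 : + p ∣ -1ℤ
  p∣-1 = ∣m+n∣m⇒∣n {m = a} (∣ᵤ⇒∣ {i = a - 1ℤ} a≡1) (∣ᵤ⇒∣ {i = a} a≡0)
  p≡1 : p ≡ 1
  p≡1 = ∣1⇒≡1 (∣⇒∣ᵤ (∣m⇒∣-m p∣-1))

IsZero-*-comm : ∀ {p} a b → IsZero p (a * b) → IsZero p (b * a)
IsZero-*-comm {p} a b = subst (IsZero p) (ℤ.*-comm a b)

m-n≡-[n∸m] : ∀ {m n} → m ≤ n → + m - + n ≡ - + (n ∸ m)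
m-n≡-[n∸m] {m} {n} m≤n = trans (ℤ.m-n≡m⊖n m n) (ℤ.⊖-≤ m≤n)

m-n≡m∸n : ∀ {m n} → n ≤ m → + m - + n ≡ + (m ∸ n)
m-n≡m∸n {m} {n} n≤m = trans (ℤ.m-n≡m⊖n m n) (ℤ.⊖-≥ n≤m)

Toeplitz : (ℤ → ℤ) → (n : ℕ) → Fin n → Fin n → ℤ
Toeplitz g n k l = g (+ toℕ k - + toℕ l)

OppositeProductsVanish : ℕ → (ℤ → ℤ) → ℕ → Set
OppositeProductsVanish p g n = ∀ d → 1 ≤ d → d < n → IsZero p (g (+ d) * g (- (+ d)))

module _ {p : ℕ} (g : ℤ → ℤ) {n : ℕ} where

  private
    M = Toeplitz g n

  Toeplitz-diagonal : ∀ k → M k k ≡ g 0ℤ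
  Toeplitz-diagonal k = cong g (ℤ.+-inverseʳ (+ toℕ k))

  Toeplitz-offDiagonal-< : OppositeProductsVanish p g n →
                           ∀ {k l} → toℕ k < toℕ l → IsZero p (M k l * M l k)
  Toeplitz-offDiagonal-< vanish {k} {l} k<l =
    subst (IsZero p) M-entries (IsZero-*-comm (g (+ d)) _ (vanish d 1≤d d<n))
    where
    d = toℕ l ∸ toℕ k
    1≤d : 1 ≤ d
    1≤d = ℕ.m<n⇒0<n∸m k<l
    d<n : d < n
    d<n = ℕ.≤-<-trans (ℕ.m∸n≤m (toℕ l) (toℕ k)) (toℕ<n l)
    M-entries : g (- + d) * g (+ d) ≡ M k l * M l k
    M-entries = sym (cong₂ (λ x y → g x * g y) (m-n≡-[n∸m] (ℕ.<⇒≤ k<l)) (m-n≡m∸n (ℕ.<⇒≤ k<l)))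

  Toeplitz-offDiagonal : OppositeProductsVanish p g n →
                         ∀ k l → k ≢ l → IsZero p (M k l * M l k)
  Toeplitz-offDiagonal vanish k l k≢l with ℕ.<-cmp (toℕ k) (toℕ l)
  ... | tri< k<l _ _ = Toeplitz-offDiagonal-< vanish k<l
  ... | tri≈ _ k≡l _ = ⊥-elim (k≢l (toℕ-injective k≡l))
  ... | tri> _ _ l<k = IsZero-*-comm (M l k) (M k l) (Toeplitz-offDiagonal-< vanish l<k)

  IsFoolingSet⇒OppositeProductsVanish : IsFoolingSet p n M → OppositeProductsVanish p g n
  IsFoolingSet⇒OppositeProductsVanish (_ , offDiagonal) d 1≤d d<n =
    subst (IsZero p) M-entries (offDiagonal (fromℕ< d<n) (fromℕ< 0<n) d≢0)
    where
    0<n : 0 < n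
    0<n = ℕ.<-trans 1≤d d<n
    d≢0 : fromℕ< d<n ≢ fromℕ< 0<n
    d≢0 d≡0 = ℕ.<⇒≢ 1≤d (sym (trans (sym (toℕ-fromℕ< d<n)) (trans (cong toℕ d≡0) (toℕ-fromℕ< 0<n))))
    M-entries : M (fromℕ< d<n) (fromℕ< 0<n) * M (fromℕ< 0<n) (fromℕ< d<n) ≡ g (+ d) * g (- + d)
    M-entries rewrite toℕ-fromℕ< d<n | toℕ-fromℕ< 0<n =
      cong₂ (λ x y → g x * g y) (ℤ.+-identityʳ (+ d)) (ℤ.+-identityˡ (- + d))

  Toeplitz-isFoolingSet : ¬ IsZero p (g 0ℤ) → OppositeProductsVanish p g n → IsFoolingSet p n M
  Toeplitz-isFoolingSet g0≢0 vanish =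
    (λ k → g0≢0 ∘ subst (IsZero p) (Toeplitz-diagonal k)) , Toeplitz-offDiagonal vanish

lemma3p3 : (p : ℕ) → Prime p → (r : ℕ) → 2 ≤ r → (f : ℤ → ℤ)
    → (∀ k → f (k + + r) ≡[ p ] - f k - f (k + 1ℤ))
    → f 0ℤ ≡[ p ] 1ℤ
    → (∀ i → 1 ≤ i → i < r → f (+ i) ≡[ p ] 0ℤ)
    → (n : ℕ) → r < n
    → IsFoolingSet p n (λ k l → f (+ toℕ k - + toℕ l))
      ⇔ (∀ k → 1 ≤ k → k < n → IsZero p (f (+ k) * f (- (+ k))))
lemma3p3 p p-prime _ _ f _ f0≡1 _ _ _ =
  mk⇔ (IsFoolingSet⇒OppositeProductsVanish f)
      (Toeplitz-isFoolingSet f (≡1⇒¬IsZero (f 0ℤ) p-prime f0≡1))
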